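{- Let $N$ be a strongly tree-child $\mathcal{L}$-network and let $T_1\ne T_2$ be distinct nontrivial root components of $N$. Then for any edge $uu'$ of $T_1$ and any edge $vv'$ of $T_2$, the directional $\mu$-vectors $\mu_d(u,u')$ and $\mu_d(v,v')$ are incomparable (neither is $\le$ the other coordinatewise).
   Context: A semidirected graph is $N=(V,E)$ with $E=E_U\sqcup E_D$, $E_U$ undirected edges $uv$, $E_D$ directed edges $(u,v)$ ($u$ parent, $v$ child); parallel directed edges allowed, no self-loops. $\deg_i(v,N)$ is the number of directed edges with child $v$. $N'$ is compatible with $N$ if obtained by directing some undirected edges. A semidirected cycle is a semidirected graph whose undirected edges can be directed to make it a directed cycle; acyclic (SDAG) means containing no semidirected cycle; DAG = acyclic directed graph. Tree node: $\deg_i\le1$; hybrid node otherwise. Hybrid edge: directed edge with hybrid child; $E_H(N)$ their set. SDAG $N'$ is phylogenetically compatible with SDAG $N$ if compatible and $E_H(N')=E_H(N)$; a rooted partner of $N$ is a DAG phylogenetically compatible with $N$; a network is an SDAG admitting a rooted partner. In a DAG, a leaf has out-degree 0; a DAG is tree-child if every non-leaf node has a child that is a tree node; a network is strongly tree-child if all its rooted partners are tree-child. A rooted leaf is a leaf in every rooted partner, an unrooted leaf a leaf in some rooted partner. For a vector $\mathcal{L}=(\ell_1,\dots,\ell_n)$ of distinct labels, an $\mathcal{L}$-network is a network whose sets of rooted and unrooted leaves coincide and are bijectively labeled by $\mathcal{L}$. For a DAG $G$ with leaves labeled by $\mathcal{L}$, $\mu(v,G)\in\mathbb{Z}_{\ge0}^n$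 has $i$-th coordinate the number of directed paths from $v$ to the leaf labeled $\ell_i$; vectors are compared coordinatewise. A semidirected path from $u_0$ to $u_n$ is $u_0\dots u_n$ with $u_{i-1}u_i$ or $(u_{i-1},u_i)$ an edge for each $i$; $v\lesssim u$ if there is a semidirected path from $u$ to $v$; $u\sim v$ if $u\lesssim v$ and $v\lesssim u$. An undirected component is the subgraph induced by a $\sim$-class; a root component is one whose class is maximal under $\lesssim$, trivial if it has one node; $E_R(N)$ is the set of edges in root components. For $uv\in E_R(N)$, the directional $\mu$-vector $\mu_d(u,v)$ is $\mu(v,G)$ for any rooted partner $G$ of $N$ in which this edge is directed as $(u,v)$ (such $G$ exists and the value is independent of the choice). -}

module Defs where

open import Data.Nat using (ℕ; zero; suc; _≤_)
open import Data.Fin using (Fin; zero; suc; inject₁; fromℕ; _≟_)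
open import Data.List using (List; map; allFin; upTo)
open import Data.Nat.ListAction using (sum)
open import Data.Product using (Σ; ∃; ∃₂; _×_; _,_)
open import Data.Sum using (_⊎_)
open import Data.Bool using (if_then_else_)
open import Relation.Nullary using (¬_)
open import Relation.Nullary.Decidable using (⌊_⌋)
open import Relation.Binary.PropositionalEquality using (_≡_; _≢_)

-- Semidirected graphs.  Nodes are Fin n, edges are indexed by Fin m
-- (so parallel edges are distinct edges).  An edge is undirected (und a b)
-- or directed (dir parent child).

data Edge (n : ℕ) : Set where
  und : Fin n → Fin n → Edge n
  dir : Fin n → Fin n → Edge n

Graph : ℕ → ℕ → Set
Graph n m = Fin m → Edge n

WF : ∀ {n m} → Graph n m → Set
WF {n} {m} N =
  (∀ (e : Fin m) (a b : Fin n) → (N e ≡ und a b ⊎ N e ≡ dir a b) → a ≢ b) ×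
  (∀ (e f : Fin m) (a b : Fin n) → N e ≡ und a b → (N f ≡ und a b ⊎ N f ≡ und b a) → e ≡ f)

childCount : ∀ {n} → Fin n → Edge n → ℕ
childCount v (und _ _) = 0
childCount v (dir _ w) = if ⌊ w ≟ v ⌋ then 1 else 0

indeg : ∀ {n m} → Graph n m → Fin n → ℕ
indeg {n} {m} N v = sum (map (λ e → childCount v (N e)) (allFin m))

TreeNode : ∀ {n m} → Graph n m → Fin n → Set
TreeNode N v = indeg N v ≤ 1

HybridNode : ∀ {n m} → Graph n m → Fin n → Set
HybridNode N v = ¬ TreeNode N v

HybridEdge : ∀ {n m} → Graph n m → Fin m → Set
HybridEdge N e = ∃₂ λ a b → N e ≡ dir a b × HybridNode N b

data Step {n m} (N : Graph n m) (a b : Fin n) (e : Fin m) : Set where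
  viaDir  : N e ≡ dir a b → Step N a b e
  viaUnd₁ : N e ≡ und a b → Step N a b e
  viaUnd₂ : N e ≡ und b a → Step N a b e

record SemidirectedCycle {n m} (N : Graph n m) : Set where
  field
    len    : ℕ   -- k = suc len
    vs     : Fin (suc (suc len)) → Fin n
    es     : Fin (suc len) → Fin m
    closed : vs (fromℕ (suc len)) ≡ vs zero
    steps  : ∀ i → Step N (vs (inject₁ i)) (vs (suc i)) (es i)
    vs-distinct : ∀ i j → vs (inject₁ i) ≡ vs (inject₁ j) → i ≡ j
    es-distinct : ∀ i j → es i ≡ es j → i ≡ j

Acyclic : ∀ {n m} → Graph n m → Set
Acyclic N = ¬ SemidirectedCycle N

Directed : ∀ {n m} → Graph n m → Set
Directed N = ∀ e → ∃₂ λ a b → N e ≡ dir a b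

DAG : ∀ {n m} → Graph n m → Set
DAG N = Directed N × Acyclic N

data CompatE {n} : Edge n → Edge n → Set where
  same : ∀ {x} → CompatE x x
  fwd  : ∀ {a b} → CompatE (und a b) (dir a b)
  bwd  : ∀ {a b} → CompatE (und a b) (dir b a)

Compatible : ∀ {n m} → Graph n m → Graph n m → Set
Compatible N N' = ∀ e → CompatE (N e) (N' e)

PhyloCompatible : ∀ {n m} → Graph n m → Graph n m → Set
PhyloCompatible N N' =
  Acyclic N × Acyclic N' × Compatible N N' ×
  (∀ e → (HybridEdge N' e → HybridEdge N e) × (HybridEdge N e → HybridEdge N' e))

RootedPartner : ∀ {n m} → Graph n m → Graph n m → Set
RootedPartner N G = DAG G × PhyloCompatible N G

Network : ∀ {n m} → Graph n m → Set
Network N = WF N × Acyclic N × ∃ λ G → RootedPartner N G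

Leaf : ∀ {n m} → Graph n m → Fin n → Set
Leaf N v = ∀ e w → N e ≢ dir v w

Child : ∀ {n m} → Graph n m → Fin n → Fin n → Set
Child N v w = ∃ λ e → N e ≡ dir v w

TreeChild : ∀ {n m} → Graph n m → Set
TreeChild N = ∀ v → ¬ Leaf N v → ∃ λ w → Child N v w × TreeNode N w

StronglyTreeChild : ∀ {n m} → Graph n m → Set
StronglyTreeChild N = ∀ G → RootedPartner N G → TreeChild G

RootedLeaf : ∀ {n m} → Graph n m → Fin n → Set
RootedLeaf N v = ∀ G → RootedPartner N G → Leaf G v

UnrootedLeaf : ∀ {n m} → Graph n m → Fin n → Set
UnrootedLeaf N v = ∃ λ G → RootedPartner N G × Leaf G v

-- L-network with L = (ℓ₁,…,ℓ_k); label ℓ_i is identified with index i,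
-- and leaf i is the node labelled ℓ_i.
LNetwork : ∀ {n m k} → Graph n m → (Fin k → Fin n) → Set
LNetwork {n} N leaf =
  Network N ×
  (∀ v → (RootedLeaf N v → UnrootedLeaf N v) × (UnrootedLeaf N v → RootedLeaf N v)) ×
  (∀ i j → leaf i ≡ leaf j → i ≡ j) ×
  (∀ v → (RootedLeaf N v → ∃ λ i → leaf i ≡ v) × ((∃ λ i → leaf i ≡ v) → RootedLeaf N v))

-- μ-vectors: counting directed paths (in a DAG, directed walks are
-- paths and have length < n)

mutual
  nwalks : ∀ {n m} → Graph n m → ℕ → Fin n → Fin n → ℕ
  nwalks G zero v w = if ⌊ v ≟ w ⌋ then 1 else 0
  nwalks {m = m} G (suc k) v w = sum (map (λ e → via G k v w (G e)) (allFin m))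

  via : ∀ {n m} → Graph n m → ℕ → Fin n → Fin n → Edge n → ℕ
  via G k v w (und _ _) = 0
  via G k v w (dir a b) = if ⌊ a ≟ v ⌋ then nwalks G k b w else 0

npaths : ∀ {n m} → Graph n m → Fin n → Fin n → ℕ
npaths {n} G v w = sum (map (λ k → nwalks G k v w) (upTo n))

μ : ∀ {n m k} → Graph n m → (Fin k → Fin n) → Fin n → Fin k → ℕ
μ G leaf v i = npaths G v (leaf i)

_≤ᵛ_ : ∀ {k} → (Fin k → ℕ) → (Fin k → ℕ) → Set
x ≤ᵛ y = ∀ i → x i ≤ y i

Incomparable : ∀ {k} → (Fin k → ℕ) → (Fin k → ℕ) → Set
Incomparable x y = ¬ (x ≤ᵛ y) × ¬ (y ≤ᵛ x)

data Reach {n m} (N : Graph n m) : Fin n → Fin n → Set where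
  here  : ∀ {a} → Reach N a a
  there : ∀ {a b c e} → Step N a b e → Reach N b c → Reach N a c

_⊢_≲_ : ∀ {n m} → Graph n m → Fin n → Fin n → Set
N ⊢ v ≲ u = Reach N u v

_⊢_∼_ : ∀ {n m} → Graph n m → Fin n → Fin n → Set
N ⊢ u ∼ v = (N ⊢ u ≲ v) × (N ⊢ v ≲ u)

-- the ∼-class of r is maximal under ≲ (r represents a root component)
RootComponentRep : ∀ {n m} → Graph n m → Fin n → Set
RootComponentRep N r = ∀ w → N ⊢ r ≲ w → N ⊢ w ≲ r

NontrivialComponent : ∀ {n m} → Graph n m → Fin n → Set
NontrivialComponent N r = ∃ λ w → w ≢ r × N ⊢ w ∼ r

-- e is an edge uu' of the undirected component of r (both ends in the
-- class of r) which may be directed as (u,u')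
EdgeOfComponent : ∀ {n m} → Graph n m → Fin n → Fin m → Fin n → Fin n → Set
EdgeOfComponent N r e u u' = CompatE (N e) (dir u u') × N ⊢ u ∼ r × N ⊢ u' ∼ r

module Submission where

open import Defs
open import Data.Nat using (ℕ; zero; suc; _≤_; _<_; z≤n; s≤s; _+_)
open import Data.Nat.Properties
  using (≤-trans; ≤-refl; ≤-reflexive; m≤m+n; m≤n+m; +-monoʳ-≤; +-comm; +-suc; 1+n≰n)
open import Data.Fin using (Fin; zero; suc; inject₁; fromℕ; _≟_)
open import Data.Fin.Properties using (any?; injective⇒≤; fromℕ≢inject₁; inject₁-injective)
open import Data.List using (List; []; _∷_; map; allFin; upTo; _++_)
open import Data.List.Membership.Propositional using (_∈_)
open import Data.List.Membership.Propositional.Properties using (∈-upTo⁺; ∈-allFin; ∈-++⁻)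
open import Data.List.Relation.Unary.Any using (here; there)
import Data.List.Membership.DecPropositional as DecMem
open import Data.Nat.ListAction using (sum)
open import Data.Product using (∃; ∃₂; _×_; _,_; proj₁; proj₂)
open import Data.Sum using (_⊎_; inj₁; inj₂)
open import Data.Unit using (⊤; tt)
open import Data.Empty using (⊥-elim)
open import Relation.Nullary using (¬_; Dec; yes; no)
open import Relation.Binary.PropositionalEquality using (_≡_; _≢_; refl; sym; trans; cong; cong₂; subst)

-- If u' lies in T₁ and v' in T₂, neither reaches the other in N, since T₁
-- and T₂ are distinct root components.  Call x separated from v' if x does not
-- reach v' in N and v' does not reach x in G₂.  This passes from x to any
-- tree-node child y of x in G₁: a G₂-path from v' to y passes through or
-- extends to x unless its last edge is a second parent edge of y, but then y
-- would be a hybrid in G₂, hence in N and in G₁.  As N is strongly tree-child,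
-- descending from u' along tree-node children of G₁ ends at a separated leaf
-- ℓ, whose coordinate is positive in μ_d(u, u') and zero in μ_d(v, v').

module _ {A : Set} (f : A → ℕ) where

  sum-map-≥ : ∀ {x xs} → x ∈ xs → f x ≤ sum (map f xs)
  sum-map-≥ {xs = y ∷ _} (here refl) = m≤m+n (f y) _
  sum-map-≥ {xs = y ∷ _} (there x∈xs) = ≤-trans (sum-map-≥ x∈xs) (m≤n+m _ (f y))

  sum-map-≥-pair : ∀ {x y xs} → x ≢ y → x ∈ xs → y ∈ xs → f x + f y ≤ sum (map f xs)
  sum-map-≥-pair x≢y (here refl) (here refl) = ⊥-elim (x≢y refl)
  sum-map-≥-pair _ (here refl) (there y∈xs) = +-monoʳ-≤ (f _) (sum-map-≥ y∈xs)
  sum-map-≥-pair {x} {y} _ (there x∈xs) (here refl) =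
    ≤-trans (≤-reflexive (+-comm (f x) (f y))) (+-monoʳ-≤ (f y) (sum-map-≥ x∈xs))
  sum-map-≥-pair {xs = z ∷ _} x≢y (there x∈xs) (there y∈xs) =
    ≤-trans (sum-map-≥-pair x≢y x∈xs y∈xs) (m≤n+m _ (f z))

  sum-map-positive : ∀ xs → 0 < sum (map f xs) → ∃ λ x → 0 < f x
  sum-map-positive (x ∷ xs) pos with f x in fx≡
  ... | zero  = sum-map-positive xs pos
  ... | suc _ = x , subst (0 <_) (sym fx≡) (s≤s z≤n)

dir-injectiveˡ : ∀ {n} {a b c d : Fin n} → dir a b ≡ dir c d → a ≡ c
dir-injectiveˡ refl = refl

module _ {n m} {N : Graph n m} where

  Reach-trans : ∀ {a b c} → Reach N a b → Reach N b c → Reach N a c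
  Reach-trans here      q = q
  Reach-trans (there s p) q = there s (Reach-trans p q)

  Reach-snoc : ∀ {a b c e} → Reach N a b → Step N b c e → Reach N a c
  Reach-snoc p s = Reach-trans p (there s here)

  Reach-unsnoc : ∀ {a c} → Reach N a c → a ≡ c ⊎ ∃₂ λ b e → Reach N a b × Step N b c e
  Reach-unsnoc here = inj₁ refl
  Reach-unsnoc (there s p) with Reach-unsnoc p
  ... | inj₁ refl              = inj₂ (_ , _ , here , s)
  ... | inj₂ (b , e , q , s') = inj₂ (b , e , there s q , s')

Directed⇒Step-dir : ∀ {n m} {G : Graph n m} → Directed G → ∀ {a b e} → Step G a b e → G e ≡ dir a b
Directed⇒Step-dir dG (viaDir eq) = eq
Directed⇒Step-dir dG {e = e} (viaUnd₁ eq) with dG e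
... | _ , _ , eq' with trans (sym eq) eq'
... | ()
Directed⇒Step-dir dG {e = e} (viaUnd₂ eq) with dG e
... | _ , _ , eq' with trans (sym eq) eq'
... | ()

CompatE-dir⇒Step : ∀ {n m} {N : Graph n m} {e a b} {z : Edge n} →
  N e ≡ z → CompatE z (dir a b) → Step N a b e
CompatE-dir⇒Step eq same = viaDir eq
CompatE-dir⇒Step eq fwd  = viaUnd₁ eq
CompatE-dir⇒Step eq bwd  = viaUnd₂ eq

CompatE-und : ∀ {n} {z : Edge n} {a b} → CompatE z (und a b) → z ≡ und a b
CompatE-und same = refl

CompatE-dir : ∀ {n} {z : Edge n} {a b} → CompatE (dir a b) z → z ≡ dir a b
CompatE-dir same = refl

CompatE-orientations : ∀ {n} {z : Edge n} {x y p q} →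
  CompatE z (dir x y) → CompatE z (dir p q) → (p ≡ x × q ≡ y) ⊎ (p ≡ y × q ≡ x)
CompatE-orientations same same = inj₁ (refl , refl)
CompatE-orientations fwd  fwd  = inj₁ (refl , refl)
CompatE-orientations fwd  bwd  = inj₂ (refl , refl)
CompatE-orientations bwd  fwd  = inj₂ (refl , refl)
CompatE-orientations bwd  bwd  = inj₁ (refl , refl)

module _ {n m} {N G : Graph n m} (comp : Compatible N G) where

  compatible-at : ∀ {e a b} → G e ≡ dir a b → CompatE (N e) (dir a b)
  compatible-at {e} eq = subst (CompatE (N e)) eq (comp e)

  compatible-dir : ∀ {e a b} → N e ≡ dir a b → G e ≡ dir a b
  compatible-dir {e} eq = CompatE-dir (subst (λ z → CompatE z (G e)) eq (comp e))

  Step-compatible : ∀ {a b e} → Step G a b e → Step N a b e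
  Step-compatible (viaDir eq)  = CompatE-dir⇒Step refl (compatible-at eq)
  Step-compatible {e = e} (viaUnd₁ eq) = viaUnd₁ (CompatE-und (subst (CompatE (N e)) eq (comp e)))
  Step-compatible {e = e} (viaUnd₂ eq) = viaUnd₂ (CompatE-und (subst (CompatE (N e)) eq (comp e)))

  Reach-compatible : ∀ {a b} → Reach G a b → Reach N a b
  Reach-compatible here        = here
  Reach-compatible (there s p) = there (Step-compatible s) (Reach-compatible p)

childCount-dir : ∀ {n} (a y : Fin n) → childCount y (dir a y) ≡ 1
childCount-dir a y with y ≟ y
... | yes _  = refl
... | no y≢y = ⊥-elim (y≢y refl)

two-parents⇒hybrid : ∀ {n m} (G : Graph n m) {e f a b y} →
  e ≢ f → G e ≡ dir a y → G f ≡ dir b y → HybridNode G y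
two-parents⇒hybrid G {e} {f} {a} {b} {y} e≢f Ge Gf indeg≤1 =
  1+n≰n (≤-trans two≤indeg indeg≤1)
  where
  two≤indeg : 2 ≤ indeg G y
  two≤indeg = subst (_≤ indeg G y)
    (cong₂ _+_ (trans (cong (childCount y) Ge) (childCount-dir a y))
               (trans (cong (childCount y) Gf) (childCount-dir b y)))
    (sum-map-≥-pair (λ g → childCount y (G g)) e≢f (∈-allFin e) (∈-allFin f))

hybrid-transfer : ∀ {n m} {N G₁ G₂ : Graph n m} → PhyloCompatible N G₁ → PhyloCompatible N G₂ →
  ∀ {g w y} → G₂ g ≡ dir w y → HybridNode G₂ y → HybridNode G₁ y
hybrid-transfer (_ , _ , comp₁ , hyb₁) (_ , _ , comp₂ , hyb₂) {g} {w} {y} G₂g hy₂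
  with proj₁ (hyb₂ g) (w , y , G₂g , hy₂)
... | hN@(a , b , Ng , _) with proj₂ (hyb₁ g) hN
... | a₁ , b₁ , G₁g , hb₁
  with trans (sym G₂g) (compatible-dir comp₂ Ng) | trans (sym G₁g) (compatible-dir comp₁ Ng)
... | refl | refl = hb₁

module Walks {n m} (G : Graph n m) where

  data Walk : Fin n → Fin n → ℕ → Set where
    nil  : ∀ {a} → Walk a a 0
    cons : ∀ {a b c k} (e : Fin m) → G e ≡ dir a b → Walk b c k → Walk a c (suc k)

  vertices : ∀ {a c k} → Walk a c k → List (Fin n)
  vertices {a} nil          = a ∷ []
  vertices {a} (cons _ _ w) = a ∷ vertices w

  Simple : ∀ {a c k} → Walk a c k → Set
  Simple nil              = ⊤
  Simple {a} (cons _ _ w) = (¬ a ∈ vertices w) × Simple w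

  snoc : ∀ {a b c k} (e : Fin m) → Walk a b k → G e ≡ dir b c → Walk a c (suc k)
  snoc e nil            p = cons e p nil
  snoc e (cons e' p' w) p = cons e' p' (snoc e w p)

  vertices-snoc : ∀ {a b c k} e (w : Walk a b k) (p : G e ≡ dir b c) →
    vertices (snoc e w p) ≡ vertices w ++ c ∷ []
  vertices-snoc e nil            p = refl
  vertices-snoc e (cons e' p' w) p = cong (_ ∷_) (vertices-snoc e w p)

  Simple-snoc : ∀ {a b c k} e (w : Walk a b k) (p : G e ≡ dir b c) →
    Simple w → ¬ c ∈ vertices w → Simple (snoc e w p)
  Simple-snoc e nil p _ c∉w = (λ { (here refl) → c∉w (here refl) }) , tt
  Simple-snoc e (cons {a = a} e' p' w) p (a∉w , sw) c∉w =
    a∉snoc , Simple-snoc e w p sw (λ c∈w → c∉w (there c∈w))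
    where
    a∉snoc : ¬ a ∈ vertices (snoc e w p)
    a∉snoc a∈ with ∈-++⁻ (vertices w) (subst (a ∈_) (vertices-snoc e w p) a∈)
    ... | inj₁ a∈w         = a∉w a∈w
    ... | inj₂ (here refl) = c∉w (here refl)

  Simple-suffix : ∀ {a c k y} (w : Walk a c k) → Simple w → y ∈ vertices w →
    ∃₂ λ k' (w' : Walk y c k') → Simple w'
  Simple-suffix nil          _        (here refl) = 0 , nil , tt
  Simple-suffix (cons e p w) sw       (here refl) = _ , cons e p w , sw
  Simple-suffix (cons e p w) (_ , sw) (there y∈w) = Simple-suffix w sw y∈w

  vertex : ∀ {a c k} → Walk a c k → Fin (suc k) → Fin n
  vertex {a} nil          zero    = a
  vertex {a} (cons _ _ w) zero    = a
  vertex     (cons _ _ w) (suc i) = vertex w i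

  edge : ∀ {a c k} → Walk a c k → Fin k → Fin m
  edge (cons e _ _) zero    = e
  edge (cons _ _ w) (suc i) = edge w i

  vertex-zero : ∀ {a c k} (w : Walk a c k) → vertex w zero ≡ a
  vertex-zero nil          = refl
  vertex-zero (cons _ _ _) = refl

  vertex-last : ∀ {a c k} (w : Walk a c k) → vertex w (fromℕ k) ≡ c
  vertex-last nil          = refl
  vertex-last (cons _ _ w) = vertex-last w

  edge-dir : ∀ {a c k} (w : Walk a c k) i → G (edge w i) ≡ dir (vertex w (inject₁ i)) (vertex w (suc i))
  edge-dir (cons e p w) zero    = trans p (cong (dir _) (sym (vertex-zero w)))
  edge-dir (cons e p w) (suc i) = edge-dir w i

  vertex∈vertices : ∀ {a c k} (w : Walk a c k) i → vertex w i ∈ vertices w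
  vertex∈vertices nil          zero    = here refl
  vertex∈vertices (cons _ _ w) zero    = here refl
  vertex∈vertices (cons _ _ w) (suc i) = there (vertex∈vertices w i)

  vertex-injective : ∀ {a c k} (w : Walk a c k) → Simple w → ∀ i j → vertex w i ≡ vertex w j → i ≡ j
  vertex-injective nil          _        zero    zero    _  = refl
  vertex-injective (cons _ _ w) _        zero    zero    _  = refl
  vertex-injective (cons _ _ w) (a∉w , _) zero    (suc j) eq = ⊥-elim (a∉w (subst (_∈ vertices w) (sym eq) (vertex∈vertices w j)))
  vertex-injective (cons _ _ w) (a∉w , _) (suc i) zero    eq = ⊥-elim (a∉w (subst (_∈ vertices w) eq (vertex∈vertices w i)))
  vertex-injective (cons _ _ w) (_ , sw)  (suc i) (suc j) eq = cong suc (vertex-injective w sw i j eq)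

  Simple⇒length< : ∀ {a c k} (w : Walk a c k) → Simple w → k < n
  Simple⇒length< w sw = injective⇒≤ (λ {i} {j} → vertex-injective w sw i j)

  closed-walk⇒cycle : ∀ {x y k} (w : Walk y x k) → Simple w → ∀ e → G e ≡ dir x y → SemidirectedCycle G
  closed-walk⇒cycle {k = k} w sw e p = record
    { len = k ; vs = vertex c ; es = edge c ; closed = vertex-last c
    ; steps = λ i → viaDir (edge-dir c i) ; vs-distinct = distinct ; es-distinct = edges-distinct }
    where
    c = cons e p w
    distinct : ∀ i j → vertex c (inject₁ i) ≡ vertex c (inject₁ j) → i ≡ j
    distinct zero    zero    _  = refl
    distinct zero    (suc j) eq = ⊥-elim (fromℕ≢inject₁ (vertex-injective w sw _ _ (trans (vertex-last w) eq)))
    distinct (suc i) zero    eq = ⊥-elim (fromℕ≢inject₁ (vertex-injective w sw _ _ (trans (vertex-last w) (sym eq))))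
    distinct (suc i) (suc j) eq = cong suc (inject₁-injective (vertex-injective w sw _ _ eq))
    edges-distinct : ∀ i j → edge c i ≡ edge c j → i ≡ j
    edges-distinct i j eq = distinct i j (dir-injectiveˡ (trans (sym (edge-dir c i)) (trans (cong G eq) (edge-dir c j))))

  via-dir-self : ∀ k a b c → nwalks G k b c ≤ via G k a c (dir a b)
  via-dir-self k a b c with a ≟ a
  ... | yes _  = ≤-refl
  ... | no a≢a = ⊥-elim (a≢a refl)

  Walk⇒0<nwalks : ∀ {a c k} → Walk a c k → 0 < nwalks G k a c
  Walk⇒0<nwalks {a} nil with a ≟ a
  ... | yes _  = s≤s z≤n
  ... | no a≢a = ⊥-elim (a≢a refl)
  Walk⇒0<nwalks {a} {c} {suc k} (cons {b = b} e p w) =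
    ≤-trans (Walk⇒0<nwalks w) (≤-trans (via-dir-self k a b c)
      (subst (λ z → via G k a c z ≤ nwalks G (suc k) a c) p
        (sum-map-≥ (λ e → via G k a c (G e)) (∈-allFin e))))

  Walk⇒0<npaths : ∀ {a c k} → Walk a c k → k < n → 0 < npaths G a c
  Walk⇒0<npaths {a} {c} w k<n =
    ≤-trans (Walk⇒0<nwalks w) (sum-map-≥ (λ k → nwalks G k a c) (∈-upTo⁺ k<n))

  mutual
    0<nwalks⇒Reach : ∀ k a c → 0 < nwalks G k a c → Reach G a c
    0<nwalks⇒Reach zero a c pos with a ≟ c
    ... | yes refl = here
    0<nwalks⇒Reach zero a c () | no _
    0<nwalks⇒Reach (suc k) a c pos with sum-map-positive (λ e → via G k a c (G e)) (allFin m) pos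
    ... | e , pos-e = 0<via⇒Reach k a c refl pos-e

    0<via⇒Reach : ∀ k a c {e} {z : Edge n} → G e ≡ z → 0 < via G k a c z → Reach G a c
    0<via⇒Reach k a c {z = und _ _} _  ()
    0<via⇒Reach k a c {z = dir p q} Ge pos with p ≟ a
    ... | yes refl = there (viaDir Ge) (0<nwalks⇒Reach k q c pos)
    0<via⇒Reach k a c {z = dir p q} Ge () | no _

  0<npaths⇒Reach : ∀ a c → 0 < npaths G a c → Reach G a c
  0<npaths⇒Reach a c pos with sum-map-positive (λ k → nwalks G k a c) (upTo n) pos
  ... | k , pos-k = 0<nwalks⇒Reach k a c pos-k

  out-edge? : ∀ x e {z} → G e ≡ z → Dec (∃ λ y → G e ≡ dir x y)
  out-edge? x e {und _ _} Ge = no λ { (_ , Ge') → und≢dir (trans (sym Ge) Ge') }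
    where
    und≢dir : ∀ {a b c d : Fin n} → und a b ≢ dir c d
    und≢dir ()
  out-edge? x e {dir a b} Ge with a ≟ x
  ... | yes refl = yes (b , Ge)
  ... | no a≢x   = no λ { (_ , Ge') → a≢x (dir-injectiveˡ (trans (sym Ge) Ge')) }

  Leaf? : ∀ x → Leaf G x ⊎ ∃₂ λ e y → G e ≡ dir x y
  Leaf? x with any? (λ e → out-edge? x e refl)
  ... | yes out = inj₂ out
  ... | no ¬out = inj₁ λ e y Ge → ¬out (e , y , Ge)

  -- The walk followed stays simple, as revisiting a node would close a cycle;
  -- hence it hits a leaf within n steps.
  descend-to-leaf : Acyclic G → (P : Fin n → Set) →
    (∀ x → P x → ¬ Leaf G x → ∃ λ y → Child G x y × P y) →
    ∀ a → P a → ∃ λ ℓ → Leaf G ℓ × P ℓ × 0 < npaths G a ℓ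
  descend-to-leaf acyclic P child a pa = go n nil tt pa (m≤m+n n 0)
    where
    go : ∀ fuel {x k} (w : Walk a x k) → Simple w → P x → n ≤ fuel + k →
      ∃ λ ℓ → Leaf G ℓ × P ℓ × 0 < npaths G a ℓ
    go zero w sw _ n≤k = ⊥-elim (1+n≰n (≤-trans (Simple⇒length< w sw) n≤k))
    go (suc fuel) {x} {k} w sw px n≤ with Leaf? x
    ... | inj₁ leaf = x , leaf , px , Walk⇒0<npaths w (Simple⇒length< w sw)
    ... | inj₂ (e , y , Ge) with child x px (λ leaf → leaf e y Ge)
    ...   | y' , (e' , Ge') , py' with DecMem._∈?_ _≟_ y' (vertices w)
    ...     | yes y'∈w = let (_ , w' , sw') = Simple-suffix w sw y'∈w
                         in ⊥-elim (acyclic (closed-walk⇒cycle w' sw' e' Ge'))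
    ...     | no y'∉w = go fuel (snoc e' w Ge') (Simple-snoc e' w Ge' sw y'∉w) py'
                          (≤-trans n≤ (≤-reflexive (sym (+-suc fuel k))))

leaf-labelled : ∀ {n m k} {N G : Graph n m} {leaf : Fin k → Fin n} →
  LNetwork N leaf → RootedPartner N G → ∀ {ℓ} → Leaf G ℓ → ∃ λ i → leaf i ≡ ℓ
leaf-labelled (_ , rooted⇔unrooted , _ , labelled⇔rooted) rp {ℓ} leaf-ℓ =
  proj₁ (labelled⇔rooted ℓ) (proj₂ (rooted⇔unrooted ℓ) (_ , rp , leaf-ℓ))

module _ {n m} {N G₁ G₂ : Graph n m} (rp₁ : RootedPartner N G₁) (rp₂ : RootedPartner N G₂) where

  private
    directed₂ = proj₁ (proj₁ rp₂)
    comp₁     = proj₁ (proj₂ (proj₂ (proj₂ rp₁)))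
    comp₂     = proj₁ (proj₂ (proj₂ (proj₂ rp₂)))

  Reach-tree-child : ∀ {e x y v} → G₁ e ≡ dir x y → TreeNode G₁ y →
    Reach G₂ v y → v ≡ y ⊎ Reach G₂ v x
  Reach-tree-child {e} G₁e tree-y r with directed₂ e
  ... | _ , _ , G₂e with CompatE-orientations (compatible-at comp₁ G₁e) (compatible-at comp₂ G₂e)
  ...   | inj₂ (refl , refl) = inj₂ (Reach-snoc r (viaDir G₂e))
  ...   | inj₁ (refl , refl) with Reach-unsnoc r
  ...     | inj₁ v≡y = inj₁ v≡y
  ...     | inj₂ (w , g , r-w , step) with Directed⇒Step-dir directed₂ step | g ≟ e
  ...       | G₂g | yes refl = inj₂ (subst (Reach G₂ _) (dir-injectiveˡ (trans (sym G₂g) G₂e)) r-w)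
  ...       | G₂g | no g≢e   = ⊥-elim (hybrid-transfer (proj₂ rp₁) (proj₂ rp₂) G₂g
                                 (two-parents⇒hybrid G₂ g≢e G₂g G₂e) tree-y)

  Separated : Fin n → Fin n → Set
  Separated v x = ¬ Reach N x v × ¬ Reach G₂ v x

  Separated-tree-child : StronglyTreeChild N → ∀ {v} x → Separated v x → ¬ Leaf G₁ x →
    ∃ λ y → Child G₁ x y × Separated v y
  Separated-tree-child stc {v} x (x↛v , v↛x) non-leaf with stc G₁ rp₁ x non-leaf
  ... | y , (e , G₁e) , tree-y = y , (e , G₁e) , y↛v , v↛y
    where
    x→y : Step N x y e
    x→y = CompatE-dir⇒Step refl (compatible-at comp₁ G₁e)
    y↛v : ¬ Reach N y v
    y↛v r = x↛v (there x→y r)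
    v↛y : ¬ Reach G₂ v y
    v↛y r with Reach-tree-child G₁e tree-y r
    ... | inj₁ refl = x↛v (there x→y here)
    ... | inj₂ r'   = v↛x r'

  μ-not-dominated : ∀ {k} {leaf : Fin k → Fin n} → LNetwork N leaf → StronglyTreeChild N →
    ∀ {u v} → ¬ N ⊢ v ≲ u → ¬ N ⊢ u ≲ v → ¬ μ G₁ leaf u ≤ᵛ μ G₂ leaf v
  μ-not-dominated {leaf = leaf} lnet stc {u} {v} u↛v v↛u μu≤μv
    with Walks.descend-to-leaf G₁ (proj₂ (proj₁ rp₁)) (Separated v) (Separated-tree-child stc)
           u (u↛v , λ r → v↛u (Reach-compatible comp₂ r))
  ... | ℓ , leaf-ℓ , (_ , v↛ℓ) , 0<paths with leaf-labelled lnet rp₁ leaf-ℓ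
  ... | i , refl = v↛ℓ (Walks.0<npaths⇒Reach G₂ v (leaf i) (≤-trans 0<paths (μu≤μv i)))

root-components-unrelated : ∀ {n m} {N : Graph n m} {r₁ r₂ u v} →
  RootComponentRep N r₂ → ¬ N ⊢ r₁ ∼ r₂ → N ⊢ u ∼ r₁ → N ⊢ v ∼ r₂ → ¬ N ⊢ v ≲ u
root-components-unrelated root₂ r₁≁r₂ (r₁→u , _) (_ , v→r₂) u→v =
  r₁≁r₂ (root₂ _ r₁→r₂ , r₁→r₂)
  where
  r₁→r₂ = Reach-trans r₁→u (Reach-trans u→v v→r₂)

proposition12 : ∀ {n m k} (N : Graph n m) (leaf : Fin k → Fin n) →
    LNetwork N leaf → StronglyTreeChild N →
    (r₁ r₂ : Fin n) →
    RootComponentRep N r₁ → NontrivialComponent N r₁ →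
    RootComponentRep N r₂ → NontrivialComponent N r₂ →
    ¬ (N ⊢ r₁ ∼ r₂) →
    (e : Fin m) (u u' : Fin n) → EdgeOfComponent N r₁ e u u' →
    (f : Fin m) (v v' : Fin n) → EdgeOfComponent N r₂ f v v' →
    (G₁ : Graph n m) → RootedPartner N G₁ → G₁ e ≡ dir u u' →
    (G₂ : Graph n m) → RootedPartner N G₂ → G₂ f ≡ dir v v' →
    Incomparable (μ G₁ leaf u') (μ G₂ leaf v')
proposition12 N leaf lnet stc r₁ r₂ root₁ _ root₂ _ r₁≁r₂
              e u u' (_ , _ , u'∼r₁) f v v' (_ , _ , v'∼r₂) G₁ rp₁ _ G₂ rp₂ _ =
  μ-not-dominated rp₁ rp₂ lnet stc u'↛v' v'↛u' ,
  μ-not-dominated rp₂ rp₁ lnet stc v'↛u' u'↛v'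
  where
  u'↛v' = root-components-unrelated root₂ r₁≁r₂ u'∼r₁ v'∼r₂
  v'↛u' = root-components-unrelated root₁ (λ (p , q) → r₁≁r₂ (q , p)) v'∼r₂ u'∼r₁
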